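{- Let $m\ge 2$ and $n\ge 1$ be integers, and for integers $m'\ge 1$ let $\mathbb{E}[X^r\mid m',n]$ denote the $r$-th moment of the classic occupancy number $X$ obtained by casting $n$ balls into $m'$ urns. Then for every integer $r\ge 0$, $$\mathbb{E}[X^r\mid m,n]=\frac{1}{m}\,\mathbb{E}[X^{r+1}\mid m,n]+\Big(1-\frac{1}{m}\Big)^{n}\,\mathbb{E}[X^r\mid m-1,n].$$
   Context: Classic occupancy model: $n$ distinguishable balls are cast independently, each into one of $m$ distinguishable urns chosen uniformly at random. The occupancy number $X$ is the number of urns containing at least one ball. -}

module Defs where

open import Data.Bool using (Bool; true; false; _∨_; if_then_else_)
open import Data.Nat using (ℕ; zero; suc; _^_; NonZero)
open import Data.Nat.Properties using (m^n≢0)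
open import Data.Fin using (Fin; _≟_)
open import Data.Vec using (Vec; []; _∷_)
open import Data.List using (List; map; allFin)
open import Data.Nat.ListAction using (sum)
open import Data.Integer using (+_)
open import Data.Rational using (ℚ; _/_; _*_; 1ℚ)
open import Relation.Nullary.Decidable using (⌊_⌋)

-- An outcome of casting n balls into m urns: ball i goes into urn (lookup v i).
-- Does urn j receive at least one ball?
hit : ∀ {m n} → Vec (Fin m) n → Fin m → Bool
hit []      j = false
hit (x ∷ v) j = ⌊ x ≟ j ⌋ ∨ hit v j

occupancy : ∀ {m n} → Vec (Fin m) n → ℕ
occupancy {m} v = sum (map (λ j → if hit v j then 1 else 0) (allFin m))

sumOutcomes : ∀ m n → (Vec (Fin m) n → ℕ) → ℕ
sumOutcomes m zero    g = g []
sumOutcomes m (suc n) g = sum (map (λ i → sumOutcomes m n (λ v → g (i ∷ v))) (allFin m))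

-- E[X^r | m, n] under the uniform distribution on the m^n outcomes (m ≥ 1).
moment : (m : ℕ) → .{{_ : NonZero m}} → (n r : ℕ) → ℚ
moment m n r = (+ sumOutcomes m n (λ v → occupancy v ^ r)) / (m ^ n)
  where instance _ = m^n≢0 m n

_^ℚ_ : ℚ → ℕ → ℚ
q ^ℚ zero  = 1ℚ
q ^ℚ suc n = q * (q ^ℚ n)

module Submission where

-- Write X(v) for the number of occupied urns of an outcome v and S(m, n, r) for
-- the sum of X(v)^r over all m^n outcomes, so that E[X^r | m, n] = S(m, n, r) / m^n.
-- Counting every urn of v once, as occupied or empty, gives pointwise
--   m · X^r = X^(r+1) + Σ_j [urn j empty in v] · X^r.
-- Summing over v, the outcomes leaving urn j empty are exactly the outcomes into
-- the other m - 1 urns (relabelled by punchIn j), and relabelling does not change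
-- X; hence the natural-number identity
--   m · S(m, n, r) = S(m, n, r + 1) + m · S(m - 1, n, r).          (powerSum-recurrence)
-- Dividing by m^(n+1) and using (1 - 1/m)^n = (m - 1)^n / m^n turns it into the
-- stated identity between rationals.                                 (recurrence-/)
-- The module Counting proves the first part, Fractions the second.

module Counting where

  open import Defs
  open import Data.Bool using (Bool; true; false; _∨_; if_then_else_)
  open import Data.Nat using (ℕ; zero; suc; _+_; _*_; _^_)
  open import Data.Nat.Properties using (+-*-semiring; +-comm; +-identityʳ)
  open import Data.Fin using (Fin; _≟_; punchIn) renaming (suc to fsuc)
  open import Data.Fin.Properties using (punchInᵢ≢i; punchIn-injective)
  open import Data.Vec using (Vec; []; _∷_) renaming (map to vmap)
  open import Data.List using (map; tabulate; allFin)
  open import Data.Nat.ListAction using () renaming (sum to listSum)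
  open import Algebra.Properties.Semiring.Sum +-*-semiring
    using (sum-syntax; sum-cong-≗; sum-remove; ∑-distrib-+; ∑-comm; *-distribʳ-sum)
  open import Function using (_∘_; id; mk⇔)
  open import Function.Definitions using (Injective)
  open import Relation.Nullary.Decidable using (⌊_⌋; does; isYes≗does; dec-true; dec-false; does-⇔)
  open import Relation.Binary.PropositionalEquality
  open ≡-Reasoning

  listSum-tabulate : ∀ {m} {A : Set} (f : A → ℕ) (g : Fin m → A) →
    listSum (map f (tabulate g)) ≡ ∑[ i < m ] f (g i)
  listSum-tabulate {zero}  f g = refl
  listSum-tabulate {suc m} f g = cong (f (g _) +_) (listSum-tabulate f (g ∘ fsuc))

  listSum-allFin : ∀ {m} (f : Fin m → ℕ) → listSum (map f (allFin m)) ≡ ∑[ i < m ] f i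
  listSum-allFin f = listSum-tabulate f id

  ∑-const : ∀ m x → ∑[ i < m ] x ≡ m * x
  ∑-const zero    x = refl
  ∑-const (suc m) x = cong (x +_) (∑-const m x)

  sumOutcomes-suc : ∀ m n (g : Vec (Fin m) (suc n) → ℕ) →
    sumOutcomes m (suc n) g ≡ ∑[ i < m ] sumOutcomes m n (λ v → g (i ∷ v))
  sumOutcomes-suc m n g = listSum-allFin (λ i → sumOutcomes m n (λ v → g (i ∷ v)))

  sumOutcomes-cong : ∀ m n {g h : Vec (Fin m) n → ℕ} → (∀ v → g v ≡ h v) →
    sumOutcomes m n g ≡ sumOutcomes m n h
  sumOutcomes-cong m zero    g≗h = g≗h []
  sumOutcomes-cong m (suc n) {g} {h} g≗h = begin
    sumOutcomes m (suc n) g                        ≡⟨ sumOutcomes-suc m n g ⟩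
    ∑[ i < m ] sumOutcomes m n (λ v → g (i ∷ v))  ≡⟨ sum-cong-≗ (λ i → sumOutcomes-cong m n (g≗h ∘ (i ∷_))) ⟩
    ∑[ i < m ] sumOutcomes m n (λ v → h (i ∷ v))  ≡⟨ sumOutcomes-suc m n h ⟨
    sumOutcomes m (suc n) h                        ∎

  sumOutcomes-+ : ∀ m n (g h : Vec (Fin m) n → ℕ) →
    sumOutcomes m n (λ v → g v + h v) ≡ sumOutcomes m n g + sumOutcomes m n h
  sumOutcomes-+ m zero    g h = refl
  sumOutcomes-+ m (suc n) g h = begin
    sumOutcomes m (suc n) (λ v → g v + h v)
      ≡⟨ sumOutcomes-suc m n (λ v → g v + h v) ⟩
    ∑[ i < m ] sumOutcomes m n (λ v → g (i ∷ v) + h (i ∷ v))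
      ≡⟨ sum-cong-≗ (λ i → sumOutcomes-+ m n (g ∘ (i ∷_)) (h ∘ (i ∷_))) ⟩
    ∑[ i < m ] (G i + H i)
      ≡⟨ ∑-distrib-+ G H ⟩
    ∑[ i < m ] G i + ∑[ i < m ] H i
      ≡⟨ cong₂ _+_ (sumOutcomes-suc m n g) (sumOutcomes-suc m n h) ⟨
    sumOutcomes m (suc n) g + sumOutcomes m (suc n) h ∎
    where
    G H : Fin m → ℕ
    G i = sumOutcomes m n (g ∘ (i ∷_))
    H i = sumOutcomes m n (h ∘ (i ∷_))

  sumOutcomes-∑ : ∀ m n {a} (h : Fin a → Vec (Fin m) n → ℕ) →
    sumOutcomes m n (λ v → ∑[ j < a ] h j v) ≡ ∑[ j < a ] sumOutcomes m n (h j)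
  sumOutcomes-∑ m zero    h = refl
  sumOutcomes-∑ m (suc n) {a} h = begin
    sumOutcomes m (suc n) (λ v → ∑[ j < a ] h j v)
      ≡⟨ sumOutcomes-suc m n (λ v → ∑[ j < a ] h j v) ⟩
    ∑[ i < m ] sumOutcomes m n (λ v → ∑[ j < a ] h j (i ∷ v))
      ≡⟨ sum-cong-≗ (λ i → sumOutcomes-∑ m n (λ j v → h j (i ∷ v))) ⟩
    ∑[ i < m ] ∑[ j < a ] sumOutcomes m n (λ v → h j (i ∷ v))
      ≡⟨ ∑-comm (λ i j → sumOutcomes m n (λ v → h j (i ∷ v))) ⟩
    ∑[ j < a ] ∑[ i < m ] sumOutcomes m n (λ v → h j (i ∷ v))
      ≡⟨ sum-cong-≗ (λ j → sumOutcomes-suc m n (h j)) ⟨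
    ∑[ j < a ] sumOutcomes m (suc n) (h j) ∎

  sumOutcomes-zero : ∀ m n → sumOutcomes m n (λ _ → 0) ≡ 0
  sumOutcomes-zero m n = sumOutcomes-∑ m n {0} (λ ())

  indicator : Bool → ℕ
  indicator b = if b then 1 else 0

  ifEmpty : Bool → ℕ → ℕ
  ifEmpty b x = if b then 0 else x

  occupancy-∑ : ∀ {m n} (v : Vec (Fin m) n) → occupancy v ≡ ∑[ j < m ] indicator (hit v j)
  occupancy-∑ v = listSum-allFin (λ j → indicator (hit v j))

  occupied-or-empty : ∀ b x → x ≡ indicator b * x + ifEmpty b x
  occupied-or-empty true  x = sym (trans (+-identityʳ (x + 0)) (+-identityʳ x))
  occupied-or-empty false x = refl

  urnCount : ∀ {m n} (v : Vec (Fin m) n) x →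
    ∑[ j < m ] x ≡ occupancy v * x + ∑[ j < m ] ifEmpty (hit v j) x
  urnCount {m} v x = begin
    ∑[ j < m ] x
      ≡⟨ sum-cong-≗ (λ j → occupied-or-empty (hit v j) x) ⟩
    ∑[ j < m ] (indicator (hit v j) * x + ifEmpty (hit v j) x)
      ≡⟨ ∑-distrib-+ (λ j → indicator (hit v j) * x) (λ j → ifEmpty (hit v j) x) ⟩
    ∑[ j < m ] (indicator (hit v j) * x) + ∑[ j < m ] ifEmpty (hit v j) x
      ≡⟨ cong (_+ ∑[ j < m ] ifEmpty (hit v j) x) (*-distribʳ-sum x (λ j → indicator (hit v j))) ⟨
    (∑[ j < m ] indicator (hit v j)) * x + ∑[ j < m ] ifEmpty (hit v j) x
      ≡⟨ cong (λ s → s * x + ∑[ j < m ] ifEmpty (hit v j) x) (occupancy-∑ v) ⟨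
    occupancy v * x + ∑[ j < m ] ifEmpty (hit v j) x ∎

  ⌊≟⌋-injective : ∀ {a b} {f : Fin a → Fin b} → Injective _≡_ _≡_ f →
    ∀ x u → ⌊ f x ≟ f u ⌋ ≡ ⌊ x ≟ u ⌋
  ⌊≟⌋-injective {f = f} f-inj x u = begin
    ⌊ f x ≟ f u ⌋    ≡⟨ isYes≗does (f x ≟ f u) ⟩
    does (f x ≟ f u) ≡⟨ does-⇔ (mk⇔ f-inj (cong f)) (f x ≟ f u) (x ≟ u) ⟩
    does (x ≟ u)     ≡⟨ isYes≗does (x ≟ u) ⟨
    ⌊ x ≟ u ⌋        ∎

  ⌊≟⌋-refl : ∀ {a} (x : Fin a) → ⌊ x ≟ x ⌋ ≡ true
  ⌊≟⌋-refl x = trans (isYes≗does (x ≟ x)) (dec-true (x ≟ x) refl)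

  ⌊≟⌋-≢ : ∀ {a} {x y : Fin a} → x ≢ y → ⌊ x ≟ y ⌋ ≡ false
  ⌊≟⌋-≢ {x = x} {y} x≢y = trans (isYes≗does (x ≟ y)) (dec-false (x ≟ y) x≢y)

  hit-map-injective : ∀ {a b n} {f : Fin a → Fin b} → Injective _≡_ _≡_ f →
    (w : Vec (Fin a) n) (u : Fin a) → hit (vmap f w) (f u) ≡ hit w u
  hit-map-injective f-inj []      u = refl
  hit-map-injective f-inj (x ∷ w) u = cong₂ _∨_ (⌊≟⌋-injective f-inj x u) (hit-map-injective f-inj w u)

  hit-map-outside : ∀ {a b n} (f : Fin a → Fin b) (j : Fin b) → (∀ u → f u ≢ j) →
    (w : Vec (Fin a) n) → hit (vmap f w) j ≡ false
  hit-map-outside f j outside []      = refl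
  hit-map-outside f j outside (x ∷ w) = cong₂ _∨_ (⌊≟⌋-≢ (outside x)) (hit-map-outside f j outside w)

  punchIn-inj : ∀ {m} (j : Fin (suc m)) → Injective _≡_ _≡_ (punchIn j)
  punchIn-inj j {x} {y} = punchIn-injective j x y

  occupancy-punchIn : ∀ {m n} (j : Fin (suc m)) (w : Vec (Fin m) n) →
    occupancy (vmap (punchIn j) w) ≡ occupancy w
  occupancy-punchIn {m} j w = begin
    occupancy v
      ≡⟨ occupancy-∑ v ⟩
    ∑[ u < suc m ] indicator (hit v u)
      ≡⟨ sum-remove {i = j} (λ u → indicator (hit v u)) ⟩
    indicator (hit v j) + ∑[ u < m ] indicator (hit v (punchIn j u))
      ≡⟨ cong₂ _+_ (cong indicator (hit-map-outside (punchIn j) j (punchInᵢ≢i j) w))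
                   (sum-cong-≗ (λ u → cong indicator (hit-map-injective (punchIn-inj j) w u))) ⟩
    ∑[ u < m ] indicator (hit w u)
      ≡⟨ occupancy-∑ w ⟨
    occupancy w ∎
    where
    v = vmap (punchIn j) w

  -- Induct on the
  -- balls: the first ball may not go into urn j, and otherwise goes to some
  -- punchIn j i.
  sumOutcomes-empty : ∀ m n (j : Fin (suc m)) (g : Vec (Fin (suc m)) n → ℕ) →
    sumOutcomes (suc m) n (λ v → ifEmpty (hit v j) (g v))
      ≡ sumOutcomes m n (λ w → g (vmap (punchIn j) w))
  sumOutcomes-empty m zero    j g = refl
  sumOutcomes-empty m (suc n) j g = begin
    sumOutcomes (suc m) (suc n) (λ v → ifEmpty (hit v j) (g v))
      ≡⟨ sumOutcomes-suc (suc m) n (λ v → ifEmpty (hit v j) (g v)) ⟩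
    ∑[ i < suc m ] F i
      ≡⟨ sum-remove {i = j} F ⟩
    F j + ∑[ i < m ] F (punchIn j i)
      ≡⟨ cong₂ _+_ firstBall-in-j (sum-cong-≗ firstBall-elsewhere) ⟩
    ∑[ i < m ] sumOutcomes m n (λ w → g (punchIn j i ∷ vmap (punchIn j) w))
      ≡⟨ sumOutcomes-suc m n (λ w → g (vmap (punchIn j) w)) ⟨
    sumOutcomes m (suc n) (λ w → g (vmap (punchIn j) w)) ∎
    where
    F : Fin (suc m) → ℕ
    F i = sumOutcomes (suc m) n (λ v → ifEmpty (⌊ i ≟ j ⌋ ∨ hit v j) (g (i ∷ v)))

    firstBall-in-j : F j ≡ 0
    firstBall-in-j = trans
      (sumOutcomes-cong (suc m) n (λ v → cong (λ b → ifEmpty (b ∨ hit v j) (g (j ∷ v))) (⌊≟⌋-refl j)))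
      (sumOutcomes-zero (suc m) n)

    firstBall-elsewhere : ∀ i →
      F (punchIn j i) ≡ sumOutcomes m n (λ w → g (punchIn j i ∷ vmap (punchIn j) w))
    firstBall-elsewhere i = trans
      (sumOutcomes-cong (suc m) n
        (λ v → cong (λ b → ifEmpty (b ∨ hit v j) (g (punchIn j i ∷ v))) (⌊≟⌋-≢ (punchInᵢ≢i j i))))
      (sumOutcomes-empty m n j (g ∘ (punchIn j i ∷_)))

  powerSum : (m n r : ℕ) → ℕ
  powerSum m n r = sumOutcomes m n (λ v → occupancy v ^ r)

  powerSum-recurrence : ∀ m n r →
    suc m * powerSum (suc m) n r ≡ powerSum (suc m) n (r + 1) + suc m * powerSum m n r
  powerSum-recurrence m n r = begin
    suc m * powerSum (suc m) n r
      ≡⟨ ∑-const (suc m) _ ⟨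
    ∑[ j < suc m ] powerSum (suc m) n r
      ≡⟨ sumOutcomes-∑ (suc m) n {suc m} (λ _ v → X v ^ r) ⟨
    sumOutcomes (suc m) n (λ v → ∑[ j < suc m ] (X v ^ r))
      ≡⟨ sumOutcomes-cong (suc m) n (λ v → urnCount v (X v ^ r)) ⟩
    sumOutcomes (suc m) n (λ v → X v * X v ^ r + ∑[ j < suc m ] ifEmpty (hit v j) (X v ^ r))
      ≡⟨ sumOutcomes-+ (suc m) n _ _ ⟩
    sumOutcomes (suc m) n (λ v → X v ^ (1 + r))
      + sumOutcomes (suc m) n (λ v → ∑[ j < suc m ] ifEmpty (hit v j) (X v ^ r))
      ≡⟨ cong₂ _+_ (sumOutcomes-cong (suc m) n (λ v → cong (X v ^_) (+-comm 1 r)))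
                   (sumOutcomes-∑ (suc m) n (λ j v → ifEmpty (hit v j) (X v ^ r))) ⟩
    powerSum (suc m) n (r + 1)
      + ∑[ j < suc m ] sumOutcomes (suc m) n (λ v → ifEmpty (hit v j) (X v ^ r))
      ≡⟨ cong (powerSum (suc m) n (r + 1) +_) (sum-cong-≗ emptyUrn) ⟩
    powerSum (suc m) n (r + 1) + ∑[ j < suc m ] powerSum m n r
      ≡⟨ cong (powerSum (suc m) n (r + 1) +_) (∑-const (suc m) (powerSum m n r)) ⟩
    powerSum (suc m) n (r + 1) + suc m * powerSum m n r ∎
    where
    X : ∀ {a} → Vec (Fin a) n → ℕ
    X = occupancy

    emptyUrn : ∀ j → sumOutcomes (suc m) n (λ v → ifEmpty (hit v j) (X v ^ r)) ≡ powerSum m n r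
    emptyUrn j = trans (sumOutcomes-empty m n j (λ v → X v ^ r))
                       (sumOutcomes-cong m n (λ w → cong (_^ r) (occupancy-punchIn j w)))


module Fractions where

  open import Defs using (_^ℚ_)
  open import Data.Nat as ℕ using (ℕ; zero; suc; NonZero; _^_)
  open import Data.Nat.Properties using (m^n≢0; m*n≢0)
  open import Data.Nat.Tactic.RingSolver using (solve-∀)
  open import Data.Integer as ℤ using (+_)
  open import Data.Integer.Properties using (pos-*; pos-+)
  open import Data.Rational using (0ℚ; 1ℚ; _/_; _*_; _-_; -_; toℚᵘ)
  open import Data.Rational using () renaming (_+_ to _+ℚ_)
  open import Data.Rational.Properties
    using (toℚᵘ-injective; fromℚᵘ-cong; toℚᵘ-fromℚᵘ; toℚᵘ-homo-*; toℚᵘ-homo-+;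
           +-assoc; +-inverseʳ; +-identityʳ)
  open import Data.Rational.Unnormalised as ℚᵘ using (mkℚᵘ; *≡*)
  import Data.Rational.Unnormalised.Properties as ℚᵘP
  open import Relation.Binary.PropositionalEquality

  toℚᵘ-/ : ∀ a b .{{_ : NonZero b}} → toℚᵘ ((+ a) / b) ℚᵘ.≃ mkℚᵘ (+ a) (ℕ.pred b)
  toℚᵘ-/ a (suc b) = toℚᵘ-fromℚᵘ (mkℚᵘ (+ a) b)

  /-cross : ∀ a b c d .{{_ : NonZero b}} .{{_ : NonZero d}} →
    a ℕ.* d ≡ c ℕ.* b → (+ a) / b ≡ (+ c) / d
  /-cross a (suc b) c (suc d) ad≡cb = fromℚᵘ-cong {mkℚᵘ (+ a) b} {mkℚᵘ (+ c) d} (*≡*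
    (trans (sym (pos-* a (suc d))) (trans (cong +_ ad≡cb) (pos-* c (suc b)))))

  /-*-/ : ∀ a b c d .{{_ : NonZero b}} .{{_ : NonZero d}} →
    ((+ a) / b) * ((+ c) / d) ≡ _/_ (+ (a ℕ.* c)) (b ℕ.* d) {{m*n≢0 b d}}
  /-*-/ a b@(suc b′) c d@(suc d′) = toℚᵘ-injective (begin
    toℚᵘ (((+ a) / b) * ((+ c) / d))
      ≈⟨ toℚᵘ-homo-* ((+ a) / b) ((+ c) / d) ⟩
    toℚᵘ ((+ a) / b) ℚᵘ.* toℚᵘ ((+ c) / d)
      ≈⟨ ℚᵘP.*-cong (toℚᵘ-/ a b) (toℚᵘ-/ c d) ⟩
    mkℚᵘ (+ a) b′ ℚᵘ.* mkℚᵘ (+ c) d′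
      ≈⟨ ℚᵘP.≃-reflexive (cong (λ z → mkℚᵘ z _) (sym (pos-* a c))) ⟩
    mkℚᵘ (+ (a ℕ.* c)) (ℕ.pred (b ℕ.* d))
      ≈⟨ toℚᵘ-/ (a ℕ.* c) (b ℕ.* d) ⟨
    toℚᵘ (_/_ (+ (a ℕ.* c)) (b ℕ.* d)) ∎)
    where open ℚᵘP.≃-Reasoning

  /-+-/ : ∀ a b c d .{{_ : NonZero b}} .{{_ : NonZero d}} →
    ((+ a) / b) +ℚ ((+ c) / d) ≡ _/_ (+ (a ℕ.* d ℕ.+ c ℕ.* b)) (b ℕ.* d) {{m*n≢0 b d}}
  /-+-/ a b@(suc b′) c d@(suc d′) = toℚᵘ-injective (begin
    toℚᵘ (((+ a) / b) +ℚ ((+ c) / d))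
      ≈⟨ toℚᵘ-homo-+ ((+ a) / b) ((+ c) / d) ⟩
    toℚᵘ ((+ a) / b) ℚᵘ.+ toℚᵘ ((+ c) / d)
      ≈⟨ ℚᵘP.+-cong (toℚᵘ-/ a b) (toℚᵘ-/ c d) ⟩
    mkℚᵘ (+ a) b′ ℚᵘ.+ mkℚᵘ (+ c) d′
      ≈⟨ ℚᵘP.≃-reflexive (cong (λ z → mkℚᵘ z _) (sym numerator)) ⟩
    mkℚᵘ (+ (a ℕ.* d ℕ.+ c ℕ.* b)) (ℕ.pred (b ℕ.* d))
      ≈⟨ toℚᵘ-/ (a ℕ.* d ℕ.+ c ℕ.* b) (b ℕ.* d) ⟨
    toℚᵘ (_/_ (+ (a ℕ.* d ℕ.+ c ℕ.* b)) (b ℕ.* d)) ∎)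
    where
    open ℚᵘP.≃-Reasoning
    numerator : + (a ℕ.* d ℕ.+ c ℕ.* b) ≡ (+ a) ℤ.* (+ d) ℤ.+ (+ c) ℤ.* (+ b)
    numerator = trans (pos-+ (a ℕ.* d) (c ℕ.* b)) (cong₂ ℤ._+_ (pos-* a d) (pos-* c b))

  /-^ : ∀ a b n .{{_ : NonZero b}} → ((+ a) / b) ^ℚ n ≡ _/_ (+ (a ^ n)) (b ^ n) {{m^n≢0 b n}}
  /-^ a b zero          = refl
  /-^ a b (suc n) {{b≢0}} =
    trans (cong (((+ a) / b) *_) (/-^ a b n)) (/-*-/ a b (a ^ n) (b ^ n) {{b≢0}} {{m^n≢0 b n}})

  -- 1 - 1/(p+1) = p/(p+1): the probability that a given ball misses a given
  -- one of p + 1 urns.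
  1-1/ : ∀ p → 1ℚ - (+ 1) / suc p ≡ (+ p) / suc p
  1-1/ p = begin
    1ℚ - x           ≡⟨ cong (_- x) y+x≡1 ⟨
    (y +ℚ x) - x     ≡⟨ +-assoc y x (- x) ⟩
    y +ℚ (x - x)     ≡⟨ cong (y +ℚ_) (+-inverseʳ x) ⟩
    y +ℚ 0ℚ          ≡⟨ +-identityʳ y ⟩
    y                ∎
    where
    open ≡-Reasoning
    x = (+ 1) / suc p
    y = (+ p) / suc p
    cross : ∀ q → (q ℕ.* suc q ℕ.+ 1 ℕ.* suc q) ℕ.* 1 ≡ 1 ℕ.* (suc q ℕ.* suc q)
    cross = solve-∀
    y+x≡1 : y +ℚ x ≡ 1ℚ
    y+x≡1 = trans (/-+-/ p (suc p) 1 (suc p))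
                  (/-cross (p ℕ.* suc p ℕ.+ 1 ℕ.* suc p) (suc p ℕ.* suc p) 1 1
                           {{m*n≢0 (suc p) (suc p)}} (cross p))

  recurrence-/ : ∀ k n A B C → suc (suc k) ℕ.* A ≡ B ℕ.+ suc (suc k) ℕ.* C →
    _/_ (+ A) (suc (suc k) ^ n) {{m^n≢0 (suc (suc k)) n}}
      ≡ ((+ 1) / suc (suc k)) * _/_ (+ B) (suc (suc k) ^ n) {{m^n≢0 (suc (suc k)) n}}
        +ℚ ((1ℚ - (+ 1) / suc (suc k)) ^ℚ n) * _/_ (+ C) (suc k ^ n) {{m^n≢0 (suc k) n}}
  recurrence-/ k n A B C mA≡B+mC = sym (begin
    ((+ 1) / m) * ((+ B) / M) +ℚ ((1ℚ - (+ 1) / m) ^ℚ n) * ((+ C) / P)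
      ≡⟨ cong (λ q → ((+ 1) / m) * ((+ B) / M) +ℚ q * ((+ C) / P)) survival ⟩
    ((+ 1) / m) * ((+ B) / M) +ℚ ((+ P) / M) * ((+ C) / P)
      ≡⟨ cong₂ _+ℚ_ (/-*-/ 1 m B M) (/-*-/ P M C P) ⟩
    (+ (1 ℕ.* B)) / (m ℕ.* M) +ℚ (+ (P ℕ.* C)) / (M ℕ.* P)
      ≡⟨ /-+-/ (1 ℕ.* B) (m ℕ.* M) (P ℕ.* C) (M ℕ.* P) ⟩
    (+ (1 ℕ.* B ℕ.* (M ℕ.* P) ℕ.+ P ℕ.* C ℕ.* (m ℕ.* M))) / (m ℕ.* M ℕ.* (M ℕ.* P))
      ≡⟨ /-cross (1 ℕ.* B ℕ.* (M ℕ.* P) ℕ.+ P ℕ.* C ℕ.* (m ℕ.* M)) (m ℕ.* M ℕ.* (M ℕ.* P)) A M cross ⟩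
    (+ A) / M ∎)
    where
    open ≡-Reasoning
    m = suc (suc k)
    M = m ^ n
    P = suc k ^ n
    instance
      M≢0 : NonZero M
      M≢0 = m^n≢0 m n
      P≢0 : NonZero P
      P≢0 = m^n≢0 (suc k) n
      mM≢0 : NonZero (m ℕ.* M)
      mM≢0 = m*n≢0 m M
      MP≢0 : NonZero (M ℕ.* P)
      MP≢0 = m*n≢0 M P
      mMMP≢0 : NonZero (m ℕ.* M ℕ.* (M ℕ.* P))
      mMMP≢0 = m*n≢0 (m ℕ.* M) (M ℕ.* P)

    survival : (1ℚ - (+ 1) / m) ^ℚ n ≡ (+ P) / M
    survival = trans (cong (_^ℚ n) (1-1/ (suc k))) (/-^ (suc k) m n)

    expand : ∀ b c x y z →
      (1 ℕ.* b ℕ.* (y ℕ.* z) ℕ.+ z ℕ.* c ℕ.* (x ℕ.* y)) ℕ.* y ≡ (b ℕ.+ x ℕ.* c) ℕ.* (y ℕ.* (y ℕ.* z))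
    expand = solve-∀
    regroup : ∀ a x y z → (x ℕ.* a) ℕ.* (y ℕ.* (y ℕ.* z)) ≡ a ℕ.* (x ℕ.* y ℕ.* (y ℕ.* z))
    regroup = solve-∀

    cross : (1 ℕ.* B ℕ.* (M ℕ.* P) ℕ.+ P ℕ.* C ℕ.* (m ℕ.* M)) ℕ.* M ≡ A ℕ.* (m ℕ.* M ℕ.* (M ℕ.* P))
    cross = begin
      (1 ℕ.* B ℕ.* (M ℕ.* P) ℕ.+ P ℕ.* C ℕ.* (m ℕ.* M)) ℕ.* M ≡⟨ expand B C m M P ⟩
      (B ℕ.+ m ℕ.* C) ℕ.* (M ℕ.* (M ℕ.* P))                   ≡⟨ cong (ℕ._* (M ℕ.* (M ℕ.* P))) mA≡B+mC ⟨
      (m ℕ.* A) ℕ.* (M ℕ.* (M ℕ.* P))                          ≡⟨ regroup A m M P ⟩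
      A ℕ.* (m ℕ.* M ℕ.* (M ℕ.* P))                             ∎


open import Defs
open import Data.Nat using (ℕ; suc; _≤_; _+_)
open import Data.Integer using (+_)
open import Data.Rational using (_/_; _*_; _-_; 1ℚ)
open import Data.Rational using () renaming (_+_ to _+ℚ_)
open import Relation.Binary.PropositionalEquality using (_≡_)
open Counting using (powerSum; powerSum-recurrence)
open Fractions using (recurrence-/)

theorem2p3 : (k n r : ℕ) → 1 ≤ n →
    moment (suc (suc k)) n r
      ≡ ((+ 1) / suc (suc k)) * moment (suc (suc k)) n (r + 1)
        +ℚ ((1ℚ - (+ 1) / suc (suc k)) ^ℚ n) * moment (suc k) n r
theorem2p3 k n r _ =
  recurrence-/ k n (powerSum (suc (suc k)) n r) (powerSum (suc (suc k)) n (r + 1)) (powerSum (suc k) n r)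
    (powerSum-recurrence (suc k) n r)
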